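{- Let $B$ be a non-trivial Boolean algebra. Let $\sim$ be the equivalence relation on $2^B$ given by $F\sim G$ iff $F\preceq G$ and $G\preceq F$, let $[F]$ be the $\sim$-class of $F$, and order the classes by $[F]\preceq[G]$ iff $F\preceq G$. Then $\langle 2^B/{\sim},\preceq\rangle$ is a lattice in which the join of $[F]$ and $[G]$ is $[F+G]$ and the meet of $[F]$ and $[G]$ is $[F\cup G]$.
   Context: $B$ is a non-trivial Boolean algebra with order $\le$ and join $+$. For $F,G\subseteq B$, $F+G=\{f+g: f\in F,\ g\in G\}$, and $F\preceq G$ ($F$ supports $G$) iff for every $g\in G$ there is $f\in F$ with $f\le g$; $\preceq$ is reflexive and transitive, so the order on classes is well defined. -}

module Defs where

open import Level using (Level; _⊔_)
open import Data.Product using (∃; ∃-syntax; _×_)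
open import Relation.Unary using (Pred; _∈_; _∪_)
open import Relation.Binary.Core using (Rel)
open import Algebra.Lattice.Bundles using (BooleanAlgebra)

module _ {c ℓ : Level} (B : BooleanAlgebra c ℓ) where
  open BooleanAlgebra B

  Subset : Set _
  Subset = Pred Carrier (c ⊔ ℓ)

  _≤B_ : Rel Carrier ℓ
  x ≤B y = (x ∨ y) ≈ y

  _⊕_ : Subset → Subset → Subset
  (F ⊕ G) x = ∃[ f ] ∃[ g ] (f ∈ F × g ∈ G × x ≈ (f ∨ g))

  _⪯_ : Rel Subset (c ⊔ ℓ)
  F ⪯ G = ∀ g → g ∈ G → ∃[ f ] (f ∈ F × f ≤B g)

  _∼_ : Rel Subset (c ⊔ ℓ)
  F ∼ G = (F ⪯ G) × (G ⪯ F)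

  _⊍_ : Subset → Subset → Subset
  F ⊍ G = F ∪ G

{-# OPTIONS --safe #-}
module Submission where

open import Defs
open import Level using (Level)
open import Relation.Nullary using (¬_)
open import Algebra.Lattice.Bundles using (BooleanAlgebra)
open import Relation.Binary.Lattice.Structures using (IsLattice; IsJoinSemilattice)
open import Data.Product using (_×_; _,_; swap; zip)
open import Data.Sum using (inj₁; inj₂)
open import Function using (flip)
open import Relation.Binary.Core using (Rel)
open import Relation.Binary.Definitions using (Reflexive; Transitive)
open import Relation.Binary.Structures using (IsPartialOrder)
open import Relation.Binary.Lattice.Definitions using (Supremum; Infimum)
open import Relation.Binary.Lattice.Bundles using (JoinSemilattice)
open import Algebra.Lattice.Properties.Lattice using (∨-orderTheoreticJoinSemilattice)

-- F ⪯ G says that G lies inside the up-set ↑F generated by F, so ⪯ is reverse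
-- inclusion of generated up-sets and ∼ identifies F with G when ↑F = ↑G.
-- Since ↑(F ∪ G) = ↑F ∪ ↑G, and ↑(F + G) = ↑F ∩ ↑G because x ≥ f and x ≥ g
-- iff x ≥ f + g, union and + are the meet and the join.

module _ {a ℓ} {A : Set a} {_≲_ : Rel A ℓ} where

  symmetricKernel-isPartialOrder : Reflexive _≲_ → Transitive _≲_ →
                                   IsPartialOrder (λ x y → x ≲ y × y ≲ x) _≲_
  symmetricKernel-isPartialOrder refl trans = record
    { isPreorder = record
      { isEquivalence = record
        { refl  = refl , refl
        ; sym   = swap
        ; trans = zip trans (flip trans)
        }
      ; reflexive = λ (x≲y , _) → x≲y
      ; trans     = trans
      }
    ; antisym = _,_
    }

module _ {c ℓ : Level} (B : BooleanAlgebra c ℓ) where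
  open BooleanAlgebra B
  private
    module ⊑ = JoinSemilattice (∨-orderTheoreticJoinSemilattice lattice)
    open ⊑ using () renaming (_≤_ to _⊑_)

    _≤_ : Rel Carrier ℓ
    _≤_ = _≤B_ B

  -- The library orders a join semilattice by x ⊑ y = y ≈ y ∨ x.
  ≤B⇒⊑ : ∀ {x y} → x ≤ y → x ⊑ y
  ≤B⇒⊑ {x} {y} x∨y≈y = sym (trans (∨-comm y x) x∨y≈y)

  ⊑⇒≤B : ∀ {x y} → x ⊑ y → x ≤ y
  ⊑⇒≤B {x} {y} y≈y∨x = trans (∨-comm x y) (sym y≈y∨x)

  ≤B-isJoinSemilattice : IsJoinSemilattice _≈_ _≤_ _∨_
  ≤B-isJoinSemilattice = record
    { isPartialOrder = record
      { isPreorder = record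
        { isEquivalence = isEquivalence
        ; reflexive     = λ x≈y → ⊑⇒≤B (⊑.reflexive x≈y)
        ; trans         = λ x≤y y≤z → ⊑⇒≤B (⊑.trans (≤B⇒⊑ x≤y) (≤B⇒⊑ y≤z))
        }
      ; antisym = λ x≤y y≤x → ⊑.antisym (≤B⇒⊑ x≤y) (≤B⇒⊑ y≤x)
      }
    ; supremum = λ x y →
          ⊑⇒≤B (⊑.x≤x∨y x y)
        , ⊑⇒≤B (⊑.y≤x∨y x y)
        , λ z x≤z y≤z → ⊑⇒≤B (⊑.∨-least (≤B⇒⊑ x≤z) (≤B⇒⊑ y≤z))
    }

  module ≤B = IsJoinSemilattice ≤B-isJoinSemilattice

  ⪯-refl : Reflexive (_⪯_ B)
  ⪯-refl g g∈F = g , g∈F , ≤B.refl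

  ⪯-trans : Transitive (_⪯_ B)
  ⪯-trans F⪯G G⪯H h h∈H =
    let g , g∈G , g≤h = G⪯H h h∈H
        f , f∈F , f≤g = F⪯G g g∈G
    in  f , f∈F , ≤B.trans f≤g g≤h

  ⊕-supremum : Supremum (_⪯_ B) (_⊕_ B)
  ⊕-supremum F G = F⪯F⊕G , G⪯F⊕G , ⊕-least
    where
    F⪯F⊕G : _⪯_ B F (_⊕_ B F G)
    F⪯F⊕G x (f , g , f∈F , _ , x≈f∨g) =
      f , f∈F , ≤B.≲-respʳ-≈ (sym x≈f∨g) (≤B.x≤x∨y f g)

    G⪯F⊕G : _⪯_ B G (_⊕_ B F G)
    G⪯F⊕G x (f , g , _ , g∈G , x≈f∨g) =
      g , g∈G , ≤B.≲-respʳ-≈ (sym x≈f∨g) (≤B.y≤x∨y f g)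

    ⊕-least : ∀ H → _⪯_ B F H → _⪯_ B G H → _⪯_ B (_⊕_ B F G) H
    ⊕-least H F⪯H G⪯H h h∈H =
      let f , f∈F , f≤h = F⪯H h h∈H
          g , g∈G , g≤h = G⪯H h h∈H
      in  f ∨ g , (f , g , f∈F , g∈G , refl) , ≤B.∨-least f≤h g≤h

  ⊍-infimum : Infimum (_⪯_ B) (_⊍_ B)
  ⊍-infimum F G =
      (λ f f∈F → f , inj₁ f∈F , ≤B.refl)
    , (λ g g∈G → g , inj₂ g∈G , ≤B.refl)
    , λ { H H⪯F H⪯G x (inj₁ x∈F) → H⪯F x x∈F
        ; H H⪯F H⪯G x (inj₂ x∈G) → H⪯G x x∈G }

proposition3p6 : {c ℓ : Level} (B : BooleanAlgebra c ℓ) →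
    ¬ (BooleanAlgebra._≈_ B (BooleanAlgebra.⊤ B) (BooleanAlgebra.⊥ B)) →
    IsLattice (_∼_ B) (_⪯_ B) (_⊕_ B) (_⊍_ B)
proposition3p6 B _ = record
  { isPartialOrder = symmetricKernel-isPartialOrder (⪯-refl B) (⪯-trans B)
  ; supremum       = ⊕-supremum B
  ; infimum        = ⊍-infimum B
  }
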